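{- Let $q$ be a prime power. For integers $n\ge0$, $m\ge0$, $$1=\sum_{0\le k\le n} f(k,m)\,r(n-k,k+m).$$
   Context: $\mathbb{F}_q$ is the finite field with $q$ elements. For $k\ge0$, $f(k,m)$ is the proportion of the $q^k$ monic polynomials $F$ of degree $k$ over $\mathbb{F}_q$ such that the set of degrees of monic divisors of $F$ has no gaps of size greater than $m$, i.e. any two consecutive elements of that set differ by at most $m$. For $j\ge1$, $r(j,m)$ is the proportion of the $q^j$ monic polynomials of degree $j$ over $\mathbb{F}_q$ all of whose non-constant divisors have degree $>m$; by convention $r(0,m)=1$. -}

module Defs where

open import Level using (0ℓ)
open import Data.Nat as ℕ using (ℕ; zero; suc; _∸_; _≤_; _<_; NonZero)
open import Data.Nat.Properties using (m^n≢0)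
open import Data.Integer using (+_)
open import Data.Rational as ℚ using (ℚ)
open import Data.Fin using (Fin)
open import Data.List using (List; []; _∷_; _++_; map; length; foldr; upTo)
open import Data.List.Membership.Propositional using (_∈_)
open import Data.List.Relation.Unary.Unique.Propositional using (Unique)
open import Data.Vec as Vec using (Vec)
open import Data.Product using (Σ; _×_)
open import Data.Empty using (⊥)
open import Relation.Nullary using (¬_)
open import Relation.Binary.PropositionalEquality using (_≡_)
open import Algebra.Core using (Op₁; Op₂)
open import Algebra.Structures using (IsCommutativeRing)
open import Function.Bundles using (_↔_; _⇔_)

-- A finite field with q elements (equality is propositional equality).
-- Existence of such a field forces q to be a prime power.
record FiniteField (q : ℕ) : Set₁ where
  field
    Carrier : Set
    _+_     : Op₂ Carrier
    _*_     : Op₂ Carrier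
    -_      : Op₁ Carrier
    0#      : Carrier
    1#      : Carrier
    isCommutativeRing : IsCommutativeRing _≡_ _+_ _*_ -_ 0# 1#
    0≢1     : ¬ (0# ≡ 1#)
    inverse : ∀ x → ¬ (x ≡ 0#) → Σ Carrier (λ y → (x * y) ≡ 1#)
    enum    : Carrier ↔ Fin q

module Polys {q : ℕ} (𝔽 : FiniteField q) where
  open FiniteField 𝔽

  -- Polynomials as coefficient lists, lowest degree first.
  Poly : Set
  Poly = List Carrier

  padd : Poly → Poly → Poly
  padd []       g        = g
  padd (a ∷ f)  []       = a ∷ f
  padd (a ∷ f)  (b ∷ g)  = (a + b) ∷ padd f g

  pmul : Poly → Poly → Poly
  pmul []      g = []
  pmul (a ∷ f) g = padd (map (a *_) g) (0# ∷ pmul f g)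

  -- A monic polynomial of degree d: its d lower coefficients a₀ … a_{d-1}.
  Monic : ℕ → Set
  Monic d = Vec Carrier d

  toPoly : ∀ {d} → Monic d → Poly
  toPoly G = Vec.toList G ++ (1# ∷ [])

  -- G divides F (the cofactor of a monic divisor of a monic polynomial is monic).
  _∣_ : ∀ {d k} → Monic d → Monic k → Set
  _∣_ {d} {k} G F = Σ ℕ (λ j → Σ (Monic j) (λ H → pmul (toPoly G) (toPoly H) ≡ toPoly F))

  IsDivDeg : ∀ {k} → Monic k → ℕ → Set
  IsDivDeg F d = Σ (Monic d) (λ G → G ∣ F)

  NoGaps : ℕ → ∀ {k} → Monic k → Set
  NoGaps m F = ∀ a b → IsDivDeg F a → IsDivDeg F b → a < b →
               (∀ c → IsDivDeg F c → a < c → c < b → ⊥) → (b ∸ a) ≤ m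

  Rough : ℕ → ∀ {k} → Monic k → Set
  Rough m F = ∀ d → (G : Monic d) → G ∣ F → 1 ≤ d → m < d

  IsCountOf : ∀ {k} → (Monic k → Set) → ℕ → Set
  IsCountOf {k} P N = Σ (List (Monic k)) (λ L →
    Unique L × ((F : Monic k) → (F ∈ L) ⇔ P F) × length L ≡ N)

  IsProportion : .{{_ : NonZero q}} → (k : ℕ) → (Monic k → Set) → ℚ → Set
  IsProportion k P x = Σ ℕ (λ N → IsCountOf P N × x ≡ ((+ N) ℚ./ (q ℕ.^ k)) {{m^n≢0 q k}})

sumTo : ℕ → (ℕ → ℚ) → ℚ
sumTo n g = foldr ℚ._+_ ℚ.0ℚ (map g (upTo (suc n)))

-- Call a monic G gap-free if the degrees of its monic divisors have no gap larger than m,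
-- and a monic H rough for G if every non-constant divisor of H has degree > deg G + m.
-- Every monic F of degree n splits uniquely as F = G H with G gap-free and H rough for G.
-- Existence: starting from G = 1, H = F, move into G any divisor of H of degree at most
-- deg G + m; the degrees of divisors of the new G still have no large gap.  Uniqueness: if
-- also F = G′ H′ with deg G ≤ deg G′, then G is coprime to H′, so G divides G′ by Gauss's
-- lemma; were G′ ≠ G, the gap-free G′ would have a divisor of degree in (deg G, deg G + m],
-- and Gauss's lemma again would make it divide G.  Counting the splittings by k = deg G gives
-- Σ_k #{gap-free of degree k} · #{rough of degree n - k for k + m} = q^n; divide by q^n.

module Submission where

open import Defs
open import Level using (0ℓ)
open import Algebra.Bundles using (CommutativeRing)
import Algebra.Properties.CommutativeSemigroup as CommutativeSemigroupProperties
import Algebra.Properties.Group as GroupProperties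
import Algebra.Properties.Ring as RingProperties
open import Data.Empty using (⊥; ⊥-elim)
open import Data.Fin using (toℕ)
import Data.Fin.Properties as FinP
import Data.Integer.Properties as ℤP
open import Data.Integer.Tactic.RingSolver using (solve-∀)
open import Data.List using (List; []; _∷_; map; foldr; length; concat; cartesianProduct; applyUpTo; allFin)
import Data.List.Properties as LP
open import Data.List.Membership.Propositional using (_∈_)
open import Data.List.Membership.Propositional.Properties
  using (∈-map⁺; ∈-map⁻; ∈-cartesianProduct⁺; ∈-cartesianProduct⁻; ∈-concat⁺′; ∈-allFin; ∈-applyUpTo⁺)
open import Data.List.Membership.Propositional.Properties.WithK using (unique∧set⇒bag)
import Data.List.Membership.DecPropositional as DecMembership
open import Data.List.Relation.Binary.BagAndSetEquality using (∼bag⇒↭)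
open import Data.List.Relation.Binary.Disjoint.Propositional using (Disjoint)
open import Data.List.Relation.Binary.Permutation.Propositional.Properties using (↭-length)
import Data.List.Relation.Unary.All as All
import Data.List.Relation.Unary.All.Properties as AllP
open import Data.List.Relation.Unary.AllPairs using ([]; _∷_)
import Data.List.Relation.Unary.AllPairs.Properties as AllPairsP
open import Data.List.Relation.Unary.Any using (here; there)
open import Data.List.Relation.Unary.Unique.Propositional using (Unique)
import Data.List.Relation.Unary.Unique.Propositional.Properties as UniqueP
open import Data.Nat as ℕ using (ℕ; zero; suc; z≤n; s≤s; _≤_; _<_; _∸_; _⊔_; _^_; _≤?_; _<?_; NonZero)
open import Data.Nat.Induction using (<-rec)
open import Data.Nat.ListAction using (sum)
import Data.Nat.Properties as ℕP
open import Data.Product using (Σ; ∃-syntax; _,_; proj₁; proj₂; _×_; uncurry)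
open import Data.Rational as ℚ using (ℚ; _/_; 0ℚ; 1ℚ; fromℚᵘ; toℚᵘ)
import Data.Rational.Properties as ℚP
open import Data.Rational.Unnormalised as ℚᵘ using (mkℚᵘ; *≡*)
import Data.Rational.Unnormalised.Properties as ℚᵘP
open import Data.Sum using (_⊎_; inj₁; inj₂)
open import Data.Vec as Vec using ([]; _∷_)
import Data.Vec.Properties as VecP
open import Effect.Monad using (RawMonad)
open import Function.Bundles using (_⇔_; mk⇔; Equivalence; Inverse; Injection)
open import Function.Construct.Symmetry using (↔-sym)
open import Function.Properties.Inverse using (↔⇒↣)
open import Relation.Binary.Bundles using (Setoid)
open import Relation.Binary.Definitions using (DecidableEquality; tri<; tri≈; tri>)
open import Relation.Binary.PropositionalEquality
import Relation.Binary.Reasoning.Setoid as SetoidReasoning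
open import Relation.Nullary using (¬_; Dec; yes; no)
open import Relation.Nullary.Decidable using (decidable-stable; ¬¬-excluded-middle)
open import Relation.Nullary.Negation using (¬¬-Monad; ¬¬-map)

open RawMonad (¬¬-Monad {0ℓ}) using (_>>=_; pure)

-- Sets of natural numbers without large gaps

GapFree : ℕ → (ℕ → Set) → Set
GapFree m P = ∀ a b → P a → P b → a < b → (∀ c → P c → a < c → c < b → ⊥) → b ∸ a ≤ m

-- Classical existence (¬ ¬) is enough here and spares us deciding membership in P.
Bridged : ℕ → ℕ → (ℕ → Set) → Set
Bridged m K P = ∀ a → a < K → ¬ ¬ (∃[ s ] P s × a < s × s ≤ a ℕ.+ m)

¬¬-minimal : (Q : ℕ → Set) {K : ℕ} → Q K → ¬ ¬ (∃[ b ] Q b × (∀ c → c < b → ¬ Q c))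
¬¬-minimal Q {K} qK noMinimal =
  <-rec (λ n → ¬ Q n) (λ n below qn → noMinimal (n , qn , λ c c<n → below c<n)) K qK

module _ {m : ℕ} {P : ℕ → Set} where

  gapFree-next : ∀ {a K} → GapFree m P → P a → P K → a < K →
                 ¬ ¬ (∃[ s ] P s × a < s × s ≤ a ℕ.+ m)
  gapFree-next {a} gapFree pa pK a<K = do
    (b , (pb , a<b) , minimal) ← ¬¬-minimal (λ s → P s × a < s) (pK , a<K)
    let b∸a≤m = gapFree a b pa pb a<b (λ c pc a<c c<b → minimal c c<b (pc , a<c))
    pure (b , pb , a<b , ℕP.≤-trans (ℕP.m≤n+m∸n b a) (ℕP.+-monoʳ-≤ a b∸a≤m))

  gapFree⇒bridged : ∀ {K} → P 0 → P K → GapFree m P → Bridged m K P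
  gapFree⇒bridged {K} p0 pK gapFree = bridge
    where
    bridge : Bridged m K P
    bridge zero 0<K = gapFree-next gapFree p0 pK 0<K
    bridge (suc a) a<K = do
      (s , ps , a<s , s≤a+m) ← bridge a (ℕP.<-trans (ℕP.n<1+n a) a<K)
      step s ps s≤a+m (ℕP.m≤n⇒m<n∨m≡n a<s)
      where
      step : ∀ s → P s → s ≤ a ℕ.+ m → suc a < s ⊎ suc a ≡ s →
             ¬ ¬ (∃[ s′ ] P s′ × suc a < s′ × s′ ≤ suc a ℕ.+ m)
      step s ps s≤a+m (inj₁ a<s) = pure (s , ps , a<s , ℕP.m≤n⇒m≤1+n s≤a+m)
      step s ps _ (inj₂ refl) = gapFree-next gapFree ps pK a<K

  bridged⇒gapFree : ∀ {K} → (∀ s → P s → s ≤ K) → Bridged m K P → GapFree m P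
  bridged⇒gapFree bounded bridged a b pa pb a<b consecutive =
    decidable-stable (b ∸ a ≤? m) do
      (s , ps , a<s , s≤a+m) ← bridged a (ℕP.<-≤-trans a<b (bounded b pb))
      pure (close s ps a<s s≤a+m)
    where
    close : ∀ s → P s → a < s → s ≤ a ℕ.+ m → b ∸ a ≤ m
    close s ps a<s s≤a+m with s <? b
    ... | yes s<b = ⊥-elim (consecutive s ps a<s s<b)
    ... | no s≮b = ℕP.m≤n+o⇒m∸n≤o b a (ℕP.≤-trans (ℕP.≮⇒≥ s≮b) s≤a+m)

bridged-shift : ∀ {m k p} {P Q : ℕ → Set} → p ≤ k ℕ.+ m →
                (∀ {s} → P s → Q s) → Q p → (∀ {s} → P s → Q (s ℕ.+ p)) →
                Bridged m k P → Bridged m (k ℕ.+ p) Q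
bridged-shift {m} {k} {p} p≤k+m P⊆Q Qp shiftP⊆Q bridgedP a a<k+p with a <? k
... | yes a<k = do
  (s , Ps , a<s , s≤a+m) ← bridgedP a a<k
  pure (s , P⊆Q Ps , a<s , s≤a+m)
... | no a≮k with a <? p
...   | yes a<p = pure (p , Qp , a<p , ℕP.≤-trans p≤k+m (ℕP.+-monoˡ-≤ m (ℕP.≮⇒≥ a≮k)))
...   | no a≮p with ℕP.m≤n⇒∃[o]m+o≡n (ℕP.≮⇒≥ a≮p)
...     | a′ , refl = do
  (s , Ps , a′<s , s≤a′+m) ← bridgedP a′ (ℕP.+-cancelˡ-< p a′ k (subst (p ℕ.+ a′ <_) (ℕP.+-comm k p) a<k+p))
  pure (s ℕ.+ p , shiftP⊆Q Ps , subst (p ℕ.+ a′ <_) (ℕP.+-comm p s) (ℕP.+-monoʳ-< p a′<s) , shifted s≤a′+m)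
  where
  shifted : ∀ {s} → s ≤ a′ ℕ.+ m → s ℕ.+ p ≤ p ℕ.+ a′ ℕ.+ m
  shifted {s} s≤a′+m = begin
    s ℕ.+ p            ≤⟨ ℕP.+-monoˡ-≤ p s≤a′+m ⟩
    a′ ℕ.+ m ℕ.+ p     ≡⟨ ℕP.+-comm (a′ ℕ.+ m) p ⟩
    p ℕ.+ (a′ ℕ.+ m)   ≡⟨ ℕP.+-assoc p a′ m ⟨
    p ℕ.+ a′ ℕ.+ m     ∎
    where open ℕP.≤-Reasoning

m^n*m^[o∸n]≡m^o : ∀ m {n o} → n ≤ o → m ^ n ℕ.* m ^ (o ∸ n) ≡ m ^ o
m^n*m^[o∸n]≡m^o m {n} {o} n≤o = trans (sym (ℕP.^-distribˡ-+-* m n (o ∸ n))) (cong (m ^_) (ℕP.m+[n∸m]≡n n≤o))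

map-unique : ∀ {A B : Set} (f : A → B) {xs : List A} → Unique xs →
             (∀ {x y} → x ∈ xs → y ∈ xs → f x ≡ f y → x ≡ y) → Unique (map f xs)
map-unique f {[]}     []          _   = []
map-unique f {x ∷ xs} (x∉xs ∷ xs!) inj =
  AllP.map⁺ (All.tabulate λ y∈xs fx≡fy → All.lookup x∉xs y∈xs (inj (here refl) (there y∈xs) fx≡fy))
  ∷ map-unique f xs! (λ x∈ y∈ → inj (there x∈) (there y∈))

length-concat : ∀ {A : Set} (xss : List (List A)) → length (concat xss) ≡ sum (map length xss)
length-concat []         = refl
length-concat (xs ∷ xss) = trans (LP.length-++ xs) (cong (length xs ℕ.+_) (length-concat xss))

length-cartesianProduct : ∀ {A B : Set} (xs : List A) (ys : List B) →
                          length (cartesianProduct xs ys) ≡ length xs ℕ.* length ys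
length-cartesianProduct []       ys = refl
length-cartesianProduct (x ∷ xs) ys =
  trans (LP.length-++ (map (x ,_) ys)) (cong₂ ℕ._+_ (LP.length-map (x ,_) ys) (length-cartesianProduct xs ys))

unique-complete-length : ∀ {A : Set} {xs ys : List A} → Unique xs → Unique ys →
                         (∀ x → x ∈ xs) → (∀ x → x ∈ ys) → length xs ≡ length ys
unique-complete-length xs! ys! all∈xs all∈ys =
  ↭-length (∼bag⇒↭ (unique∧set⇒bag xs! ys! (λ {x} → mk⇔ (λ _ → all∈ys x) (λ _ → all∈xs x))))

applyUpTo-cong : ∀ {A : Set} {f g : ℕ → A} n → (∀ {k} → k < n → f k ≡ g k) → applyUpTo f n ≡ applyUpTo g n
applyUpTo-cong zero    f≗g = refl
applyUpTo-cong (suc n) f≗g = cong₂ _∷_ (f≗g (s≤s z≤n)) (applyUpTo-cong n (λ k<n → f≗g (s≤s k<n)))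

module Fractions where
  open import Data.Integer using (ℤ; +_; _+_; _*_)

  fromℚᵘ-homo-+ : ∀ x y → fromℚᵘ x ℚ.+ fromℚᵘ y ≡ fromℚᵘ (x ℚᵘ.+ y)
  fromℚᵘ-homo-+ x y = ℚP.toℚᵘ-injective (begin
    toℚᵘ (fromℚᵘ x ℚ.+ fromℚᵘ y)               ≈⟨ ℚP.toℚᵘ-homo-+ (fromℚᵘ x) (fromℚᵘ y) ⟩
    toℚᵘ (fromℚᵘ x) ℚᵘ.+ toℚᵘ (fromℚᵘ y)      ≈⟨ ℚᵘP.+-cong (ℚP.toℚᵘ-fromℚᵘ x) (ℚP.toℚᵘ-fromℚᵘ y) ⟩
    x ℚᵘ.+ y                                  ≈⟨ ℚᵘP.≃-sym (ℚP.toℚᵘ-fromℚᵘ (x ℚᵘ.+ y)) ⟩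
    toℚᵘ (fromℚᵘ (x ℚᵘ.+ y))                  ∎)
    where open ℚᵘP.≃-Reasoning

  fromℚᵘ-homo-* : ∀ x y → fromℚᵘ x ℚ.* fromℚᵘ y ≡ fromℚᵘ (x ℚᵘ.* y)
  fromℚᵘ-homo-* x y = ℚP.toℚᵘ-injective (begin
    toℚᵘ (fromℚᵘ x ℚ.* fromℚᵘ y)               ≈⟨ ℚP.toℚᵘ-homo-* (fromℚᵘ x) (fromℚᵘ y) ⟩
    toℚᵘ (fromℚᵘ x) ℚᵘ.* toℚᵘ (fromℚᵘ y)      ≈⟨ ℚᵘP.*-cong (ℚP.toℚᵘ-fromℚᵘ x) (ℚP.toℚᵘ-fromℚᵘ y) ⟩
    x ℚᵘ.* y                                  ≈⟨ ℚᵘP.≃-sym (ℚP.toℚᵘ-fromℚᵘ (x ℚᵘ.* y)) ⟩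
    toℚᵘ (fromℚᵘ (x ℚᵘ.* y))                  ∎)
    where open ℚᵘP.≃-Reasoning

  -- + a / suc b is by definition fromℚᵘ (mkℚᵘ (+ a) b), so the arithmetic can be done in ℚᵘ.
  /-* : ∀ a b c d .{{_ : NonZero b}} .{{_ : NonZero d}} {e} .{{_ : NonZero e}} → b ℕ.* d ≡ e →
        (+ a / b) ℚ.* (+ c / d) ≡ + (a ℕ.* c) / e
  /-* a b@(suc b-1) c d@(suc d-1) refl =
    trans (fromℚᵘ-homo-* (mkℚᵘ (+ a) b-1) (mkℚᵘ (+ c) d-1)) (cong (_/ (b ℕ.* d)) (sym (ℤP.pos-* a c)))

  /-+ : ∀ a c b .{{_ : NonZero b}} → (+ a / b) ℚ.+ (+ c / b) ≡ + (a ℕ.+ c) / b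
  /-+ a c b@(suc b-1) =
    trans (fromℚᵘ-homo-+ x y) (ℚP.fromℚᵘ-cong {x ℚᵘ.+ y} {mkℚᵘ (+ (a ℕ.+ c)) b-1} (*≡* (begin
      (+ a * + b + + c * + b) * + b  ≡⟨ cross-multiplied (+ a) (+ c) (+ b) ⟩
      (+ a + + c) * (+ b * + b)      ≡⟨ cong₂ _*_ (sym (ℤP.pos-+ a c)) (sym (ℤP.pos-* b b)) ⟩
      + (a ℕ.+ c) * + (b ℕ.* b)      ∎)))
    where
    open ≡-Reasoning
    x = mkℚᵘ (+ a) b-1
    y = mkℚᵘ (+ c) b-1
    cross-multiplied : ∀ (x y z : ℤ) → (x * z + y * z) * z ≡ (x + y) * (z * z)
    cross-multiplied = solve-∀

  n/n≡1 : ∀ b .{{_ : NonZero b}} → + b / b ≡ 1ℚ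
  n/n≡1 b@(suc b-1) = ℚP.fromℚᵘ-cong {mkℚᵘ (+ b) b-1} {mkℚᵘ (+ 1) 0} (*≡* (ℤP.*-comm (+ b) (+ 1)))

  sum-/ : ∀ b .{{_ : NonZero b}} (h : ℕ → ℕ) N →
          foldr ℚ._+_ 0ℚ (applyUpTo (λ k → + h k / b) N) ≡ + sum (applyUpTo h N) / b
  sum-/ b h zero    = sym (ℚP.0/n≡0 b)
  sum-/ b h (suc N) = trans (cong (+ h 0 / b ℚ.+_) (sum-/ b h′ N)) (/-+ (h 0) (sum (applyUpTo h′ N)) b)
    where h′ = λ k → h (suc k)

open Fractions

module MonicFactorisation {q : ℕ} (𝔽 : FiniteField q) where
  open FiniteField 𝔽 using (Carrier; enum; inverse; 0≢1)
  open Polys 𝔽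

  ring : CommutativeRing 0ℓ 0ℓ
  ring = record { isCommutativeRing = FiniteField.isCommutativeRing 𝔽 }

  open CommutativeRing ring
    using (_+_; _*_; -_; 0#; 1#; +-assoc; +-comm; +-identityˡ; +-identityʳ; *-assoc; *-comm;
           *-identityˡ; *-identityʳ; distribˡ; distribʳ; zeroˡ; zeroʳ; -‿inverseʳ;
           +-commutativeSemigroup; +-group)
  open CommutativeSemigroupProperties +-commutativeSemigroup using (interchange; x∙yz≈y∙xz)
  open GroupProperties +-group using (x∙y⁻¹≈ε⇒x≈y)
  open RingProperties (CommutativeRing.ring ring) using (-1*x≈-x)

  -- Polynomial arithmetic, up to coefficientwise equality

  _≟_ : DecidableEquality Carrier
  _≟_ = FinP.inj⇒≟ (↔⇒↣ enum)

  coeff : Poly → ℕ → Carrier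
  coeff []      i       = 0#
  coeff (a ∷ f) zero    = a
  coeff (a ∷ f) (suc i) = coeff f i

  -- Coefficient lists differing by trailing zeros denote the same polynomial.
  infix 4 _≈_
  record _≈_ (f g : Poly) : Set where
    constructor coeffwise
    field at : ∀ i → coeff f i ≡ coeff g i
  open _≈_

  ≈-setoid : Setoid 0ℓ 0ℓ
  ≈-setoid = record
    { Carrier       = Poly
    ; _≈_           = _≈_
    ; isEquivalence = record
      { refl  = coeffwise λ _ → refl
      ; sym   = λ p → coeffwise λ i → sym (at p i)
      ; trans = λ p r → coeffwise λ i → trans (at p i) (at r i)
      }
    }
  open Setoid ≈-setoid using () renaming (refl to ≈-refl; sym to ≈-sym; trans to ≈-trans)
  module ≈-Reasoning = SetoidReasoning ≈-setoid

  ≡⇒≈ : ∀ {f g} → f ≡ g → f ≈ g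
  ≡⇒≈ refl = ≈-refl

  IsZero : Poly → Set
  IsZero f = f ≈ []

  ∷-cong : ∀ {a b f g} → a ≡ b → f ≈ g → a ∷ f ≈ b ∷ g
  ∷-cong a≡b f≈g = coeffwise λ { zero → a≡b ; (suc i) → at f≈g i }

  ∷-injective : ∀ {a b f g} → a ∷ f ≈ b ∷ g → f ≈ g
  ∷-injective e = coeffwise λ i → at e (suc i)

  zero-tail : ∀ {a f} → IsZero (a ∷ f) → IsZero f
  zero-tail e = coeffwise λ i → at e (suc i)

  0∷-zero : ∀ {f} → IsZero f → IsZero (0# ∷ f)
  0∷-zero f≈0 = coeffwise λ { zero → refl ; (suc i) → at f≈0 i }

  scale : Carrier → Poly → Poly
  scale a = map (a *_)

  coeff-padd : ∀ f g i → coeff (padd f g) i ≡ coeff f i + coeff g i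
  coeff-padd []      g       i       = sym (+-identityˡ _)
  coeff-padd (a ∷ f) []      i       = sym (+-identityʳ _)
  coeff-padd (a ∷ f) (b ∷ g) zero    = refl
  coeff-padd (a ∷ f) (b ∷ g) (suc i) = coeff-padd f g i

  coeff-scale : ∀ a f i → coeff (scale a f) i ≡ a * coeff f i
  coeff-scale a []      i       = sym (zeroʳ a)
  coeff-scale a (b ∷ f) zero    = refl
  coeff-scale a (b ∷ f) (suc i) = coeff-scale a f i

  coeff-pmul-∷ : ∀ a f g i → coeff (pmul (a ∷ f) g) i ≡ a * coeff g i + coeff (0# ∷ pmul f g) i
  coeff-pmul-∷ a f g i =
    trans (coeff-padd (scale a g) (0# ∷ pmul f g) i) (cong (_+ _) (coeff-scale a g i))

  padd-lift : ∀ f g h k → (∀ i → coeff f i + coeff g i ≡ coeff h i + coeff k i) →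
              padd f g ≈ padd h k
  padd-lift f g h k e =
    coeffwise λ i → trans (coeff-padd f g i) (trans (e i) (sym (coeff-padd h k i)))

  padd-cong : ∀ {f f′ g g′} → f ≈ f′ → g ≈ g′ → padd f g ≈ padd f′ g′
  padd-cong {f} {f′} {g} {g′} f≈f′ g≈g′ = padd-lift f g f′ g′ λ i → cong₂ _+_ (at f≈f′ i) (at g≈g′ i)

  padd-comm : ∀ f g → padd f g ≈ padd g f
  padd-comm f g = padd-lift f g g f λ i → +-comm _ _

  padd-assoc : ∀ f g h → padd (padd f g) h ≈ padd f (padd g h)
  padd-assoc f g h = padd-lift (padd f g) h f (padd g h) λ i → begin
    coeff (padd f g) i + coeff h i      ≡⟨ cong (_+ coeff h i) (coeff-padd f g i) ⟩
    coeff f i + coeff g i + coeff h i   ≡⟨ +-assoc _ _ _ ⟩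
    coeff f i + (coeff g i + coeff h i) ≡⟨ cong (coeff f i +_) (sym (coeff-padd g h i)) ⟩
    coeff f i + coeff (padd g h) i      ∎
    where open ≡-Reasoning

  padd-interchange : ∀ f g h k → padd (padd f g) (padd h k) ≈ padd (padd f h) (padd g k)
  padd-interchange f g h k = padd-lift (padd f g) (padd h k) (padd f h) (padd g k) λ i → begin
    coeff (padd f g) i + coeff (padd h k) i            ≡⟨ cong₂ _+_ (coeff-padd f g i) (coeff-padd h k i) ⟩
    (coeff f i + coeff g i) + (coeff h i + coeff k i)  ≡⟨ interchange _ _ _ _ ⟩
    (coeff f i + coeff h i) + (coeff g i + coeff k i)  ≡⟨ sym (cong₂ _+_ (coeff-padd f h i) (coeff-padd g k i)) ⟩
    coeff (padd f h) i + coeff (padd g k) i            ∎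
    where open ≡-Reasoning

  padd-leftComm : ∀ f g h → padd f (padd g h) ≈ padd g (padd f h)
  padd-leftComm f g h = padd-lift f (padd g h) g (padd f h) λ i → begin
    coeff f i + coeff (padd g h) i       ≡⟨ cong (coeff f i +_) (coeff-padd g h i) ⟩
    coeff f i + (coeff g i + coeff h i)  ≡⟨ x∙yz≈y∙xz _ _ _ ⟩
    coeff g i + (coeff f i + coeff h i)  ≡⟨ cong (coeff g i +_) (sym (coeff-padd f h i)) ⟩
    coeff g i + coeff (padd f h) i       ∎
    where open ≡-Reasoning

  0∷-padd : ∀ f g → 0# ∷ padd f g ≈ padd (0# ∷ f) (0# ∷ g)
  0∷-padd f g = ∷-cong (sym (+-identityʳ 0#)) ≈-refl

  padd-identityˡ : ∀ {z} g → IsZero z → padd z g ≈ g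
  padd-identityˡ {z} g z≈0 =
    coeffwise λ i → trans (coeff-padd z g i) (trans (cong (_+ coeff g i) (at z≈0 i)) (+-identityˡ _))

  padd-identityʳ : ∀ f {z} → IsZero z → padd f z ≈ f
  padd-identityʳ f {z} z≈0 = ≈-trans (padd-comm f z) (padd-identityˡ f z≈0)

  scale-congʳ : ∀ a {f g} → f ≈ g → scale a f ≈ scale a g
  scale-congʳ a {f} {g} f≈g =
    coeffwise λ i → trans (coeff-scale a f i) (trans (cong (a *_) (at f≈g i)) (sym (coeff-scale a g i)))

  scale-congˡ : ∀ {a b} g → a ≡ b → scale a g ≈ scale b g
  scale-congˡ g refl = ≈-refl

  scale-zero : ∀ g → IsZero (scale 0# g)
  scale-zero g = coeffwise λ i → trans (coeff-scale 0# g i) (zeroˡ _)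

  scale-one : ∀ g → scale 1# g ≈ g
  scale-one g = coeffwise λ i → trans (coeff-scale 1# g i) (*-identityˡ _)

  scale-scale : ∀ a b g → scale a (scale b g) ≈ scale (a * b) g
  scale-scale a b g = coeffwise λ i → begin
    coeff (scale a (scale b g)) i ≡⟨ coeff-scale a (scale b g) i ⟩
    a * coeff (scale b g) i       ≡⟨ cong (a *_) (coeff-scale b g i) ⟩
    a * (b * coeff g i)           ≡⟨ sym (*-assoc a b _) ⟩
    a * b * coeff g i             ≡⟨ sym (coeff-scale (a * b) g i) ⟩
    coeff (scale (a * b) g) i     ∎
    where open ≡-Reasoning

  scale-comm : ∀ a b g → scale a (scale b g) ≈ scale b (scale a g)
  scale-comm a b g =
    ≈-trans (scale-scale a b g) (≈-trans (scale-congˡ g (*-comm a b)) (≈-sym (scale-scale b a g)))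

  scale-padd : ∀ a g h → scale a (padd g h) ≈ padd (scale a g) (scale a h)
  scale-padd a g h = coeffwise λ i → begin
    coeff (scale a (padd g h)) i                ≡⟨ coeff-scale a (padd g h) i ⟩
    a * coeff (padd g h) i                      ≡⟨ cong (a *_) (coeff-padd g h i) ⟩
    a * (coeff g i + coeff h i)                 ≡⟨ distribˡ a _ _ ⟩
    a * coeff g i + a * coeff h i               ≡⟨ sym (cong₂ _+_ (coeff-scale a g i) (coeff-scale a h i)) ⟩
    coeff (scale a g) i + coeff (scale a h) i   ≡⟨ sym (coeff-padd (scale a g) (scale a h) i) ⟩
    coeff (padd (scale a g) (scale a h)) i      ∎
    where open ≡-Reasoning

  scale-distrib : ∀ a b g → scale (a + b) g ≈ padd (scale a g) (scale b g)
  scale-distrib a b g = coeffwise λ i → begin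
    coeff (scale (a + b) g) i                   ≡⟨ coeff-scale (a + b) g i ⟩
    (a + b) * coeff g i                         ≡⟨ distribʳ _ a b ⟩
    a * coeff g i + b * coeff g i               ≡⟨ sym (cong₂ _+_ (coeff-scale a g i) (coeff-scale b g i)) ⟩
    coeff (scale a g) i + coeff (scale b g) i   ≡⟨ sym (coeff-padd (scale a g) (scale b g) i) ⟩
    coeff (padd (scale a g) (scale b g)) i      ∎
    where open ≡-Reasoning

  scale-inverse : ∀ a g → IsZero (padd (scale a g) (scale (- a) g))
  scale-inverse a g = coeffwise λ i → begin
    coeff (padd (scale a g) (scale (- a) g)) i  ≡⟨ coeff-padd (scale a g) (scale (- a) g) i ⟩
    coeff (scale a g) i + coeff (scale (- a) g) i ≡⟨ cong₂ _+_ (coeff-scale a g i) (coeff-scale (- a) g i) ⟩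
    a * coeff g i + (- a) * coeff g i           ≡⟨ sym (distribʳ _ a (- a)) ⟩
    (a + - a) * coeff g i                       ≡⟨ cong (_* coeff g i) (-‿inverseʳ a) ⟩
    0# * coeff g i                              ≡⟨ zeroˡ _ ⟩
    0#                                          ∎
    where open ≡-Reasoning

  neg : Poly → Poly
  neg = scale (- 1#)

  padd-inverseʳ : ∀ f → IsZero (padd f (neg f))
  padd-inverseʳ f = ≈-trans (padd-cong (≈-sym (scale-one f)) ≈-refl) (scale-inverse 1# f)

  padd-solve : ∀ {P U R} → P ≈ padd U R → R ≈ padd P (neg U)
  padd-solve {P} {U} {R} P≈U+R = ≈-sym (begin
    padd P (neg U)                   ≈⟨ padd-cong (≈-trans P≈U+R (padd-comm U R)) ≈-refl ⟩
    padd (padd R U) (neg U)          ≈⟨ padd-assoc R U (neg U) ⟩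
    padd R (padd U (neg U))          ≈⟨ padd-identityʳ R (padd-inverseʳ U) ⟩
    R                                ∎)
    where open ≈-Reasoning

  pmul-zeroˡ : ∀ {f} g → IsZero f → IsZero (pmul f g)
  pmul-zeroˡ {[]}    g f≈0 = ≈-refl
  pmul-zeroˡ {a ∷ f} g f≈0 = begin
    padd (scale a g) (0# ∷ pmul f g)   ≈⟨ padd-cong (scale-congˡ g (at f≈0 zero)) ≈-refl ⟩
    padd (scale 0# g) (0# ∷ pmul f g)  ≈⟨ padd-identityˡ (0# ∷ pmul f g) (scale-zero g) ⟩
    0# ∷ pmul f g                      ≈⟨ 0∷-zero (pmul-zeroˡ g (zero-tail f≈0)) ⟩
    []                                 ∎
    where open ≈-Reasoning

  pmul-zeroʳ : ∀ f → IsZero (pmul f [])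
  pmul-zeroʳ []      = ≈-refl
  pmul-zeroʳ (a ∷ f) = 0∷-zero (pmul-zeroʳ f)

  pmul-congˡ : ∀ {f f′} g → f ≈ f′ → pmul f g ≈ pmul f′ g
  pmul-congˡ {[]}    {f′}     g f≈f′ = ≈-sym (pmul-zeroˡ g (≈-sym f≈f′))
  pmul-congˡ {a ∷ f} {[]}     g f≈f′ = pmul-zeroˡ g f≈f′
  pmul-congˡ {a ∷ f} {b ∷ f′} g f≈f′ =
    padd-cong (scale-congˡ g (at f≈f′ zero)) (∷-cong refl (pmul-congˡ g (∷-injective f≈f′)))

  pmul-congʳ : ∀ f {g g′} → g ≈ g′ → pmul f g ≈ pmul f g′
  pmul-congʳ []      g≈g′ = ≈-refl
  pmul-congʳ (a ∷ f) g≈g′ = padd-cong (scale-congʳ a g≈g′) (∷-cong refl (pmul-congʳ f g≈g′))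

  pmul-0∷ : ∀ f g → pmul (0# ∷ f) g ≈ 0# ∷ pmul f g
  pmul-0∷ f g = padd-identityˡ (0# ∷ pmul f g) (scale-zero g)

  pmul-distribʳ : ∀ f f′ g → pmul (padd f f′) g ≈ padd (pmul f g) (pmul f′ g)
  pmul-distribʳ []      f′       g = ≈-refl
  pmul-distribʳ (a ∷ f) []       g = ≈-sym (padd-identityʳ (pmul (a ∷ f) g) ≈-refl)
  pmul-distribʳ (a ∷ f) (b ∷ f′) g = begin
    padd (scale (a + b) g) (0# ∷ pmul (padd f f′) g)
      ≈⟨ padd-cong (scale-distrib a b g) (≈-trans (∷-cong refl (pmul-distribʳ f f′ g)) (0∷-padd (pmul f g) (pmul f′ g))) ⟩
    padd (padd (scale a g) (scale b g)) (padd (0# ∷ pmul f g) (0# ∷ pmul f′ g))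
      ≈⟨ padd-interchange (scale a g) (scale b g) (0# ∷ pmul f g) (0# ∷ pmul f′ g) ⟩
    padd (pmul (a ∷ f) g) (pmul (b ∷ f′) g) ∎
    where open ≈-Reasoning

  pmul-distribˡ : ∀ f g g′ → pmul f (padd g g′) ≈ padd (pmul f g) (pmul f g′)
  pmul-distribˡ []      g g′ = ≈-refl
  pmul-distribˡ (a ∷ f) g g′ = begin
    padd (scale a (padd g g′)) (0# ∷ pmul f (padd g g′))
      ≈⟨ padd-cong (scale-padd a g g′) (≈-trans (∷-cong refl (pmul-distribˡ f g g′)) (0∷-padd (pmul f g) (pmul f g′))) ⟩
    padd (padd (scale a g) (scale a g′)) (padd (0# ∷ pmul f g) (0# ∷ pmul f g′))
      ≈⟨ padd-interchange (scale a g) (scale a g′) (0# ∷ pmul f g) (0# ∷ pmul f g′) ⟩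
    padd (pmul (a ∷ f) g) (pmul (a ∷ f) g′) ∎
    where open ≈-Reasoning

  pmul-scaleˡ : ∀ a f g → pmul (scale a f) g ≈ scale a (pmul f g)
  pmul-scaleˡ a []      g = ≈-refl
  pmul-scaleˡ a (b ∷ f) g = begin
    padd (scale (a * b) g) (0# ∷ pmul (scale a f) g)
      ≈⟨ padd-cong (≈-sym (scale-scale a b g)) (∷-cong (sym (zeroʳ a)) (pmul-scaleˡ a f g)) ⟩
    padd (scale a (scale b g)) (scale a (0# ∷ pmul f g))
      ≈⟨ ≈-sym (scale-padd a (scale b g) (0# ∷ pmul f g)) ⟩
    scale a (pmul (b ∷ f) g) ∎
    where open ≈-Reasoning

  pmul-scaleʳ : ∀ a f g → pmul f (scale a g) ≈ scale a (pmul f g)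
  pmul-scaleʳ a []      g = ≈-refl
  pmul-scaleʳ a (b ∷ f) g = begin
    padd (scale b (scale a g)) (0# ∷ pmul f (scale a g))
      ≈⟨ padd-cong (scale-comm b a g) (∷-cong (sym (zeroʳ a)) (pmul-scaleʳ a f g)) ⟩
    padd (scale a (scale b g)) (scale a (0# ∷ pmul f g))
      ≈⟨ ≈-sym (scale-padd a (scale b g) (0# ∷ pmul f g)) ⟩
    scale a (pmul (b ∷ f) g) ∎
    where open ≈-Reasoning

  pmul-∷ʳ : ∀ f b g → pmul f (b ∷ g) ≈ padd (scale b f) (0# ∷ pmul f g)
  pmul-∷ʳ []      b g = ≈-sym (0∷-zero ≈-refl)
  pmul-∷ʳ (a ∷ f) b g = ∷-cong (cong (_+ 0#) (*-comm a b)) (begin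
    padd (scale a g) (pmul f (b ∷ g))
      ≈⟨ padd-cong ≈-refl (pmul-∷ʳ f b g) ⟩
    padd (scale a g) (padd (scale b f) (0# ∷ pmul f g))
      ≈⟨ padd-leftComm (scale a g) (scale b f) (0# ∷ pmul f g) ⟩
    padd (scale b f) (padd (scale a g) (0# ∷ pmul f g)) ∎)
    where open ≈-Reasoning

  pmul-comm : ∀ f g → pmul f g ≈ pmul g f
  pmul-comm []      g = ≈-sym (pmul-zeroʳ g)
  pmul-comm (a ∷ f) g =
    ≈-trans (padd-cong ≈-refl (∷-cong refl (pmul-comm f g))) (≈-sym (pmul-∷ʳ g a f))

  pmul-assoc : ∀ f g h → pmul (pmul f g) h ≈ pmul f (pmul g h)
  pmul-assoc []      g h = ≈-refl
  pmul-assoc (a ∷ f) g h = begin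
    pmul (padd (scale a g) (0# ∷ pmul f g)) h
      ≈⟨ pmul-distribʳ (scale a g) (0# ∷ pmul f g) h ⟩
    padd (pmul (scale a g) h) (pmul (0# ∷ pmul f g) h)
      ≈⟨ padd-cong (pmul-scaleˡ a g h) (≈-trans (pmul-0∷ (pmul f g) h) (∷-cong refl (pmul-assoc f g h))) ⟩
    padd (scale a (pmul g h)) (0# ∷ pmul f (pmul g h)) ∎
    where open ≈-Reasoning

  pmul-identityʳ : ∀ f → pmul f (1# ∷ []) ≈ f
  pmul-identityʳ f = begin
    pmul f (1# ∷ [])                 ≈⟨ pmul-∷ʳ f 1# [] ⟩
    padd (scale 1# f) (0# ∷ pmul f []) ≈⟨ padd-identityʳ (scale 1# f) (0∷-zero (pmul-zeroʳ f)) ⟩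
    scale 1# f                       ≈⟨ scale-one f ⟩
    f                                ∎
    where open ≈-Reasoning

  pmul-identityˡ : ∀ f → pmul (1# ∷ []) f ≈ f
  pmul-identityˡ f = ≈-trans (pmul-comm (1# ∷ []) f) (pmul-identityʳ f)

  pmul-constʳ : ∀ f c → pmul f (c ∷ []) ≈ scale c f
  pmul-constʳ f c = ≈-trans (pmul-∷ʳ f c []) (padd-identityʳ (scale c f) (0∷-zero (pmul-zeroʳ f)))

  pmul-0∷ʳ : ∀ f g → pmul f (0# ∷ g) ≈ 0# ∷ pmul f g
  pmul-0∷ʳ f g = ≈-trans (pmul-∷ʳ f 0# g) (padd-identityˡ (0# ∷ pmul f g) (scale-zero f))

  -- Degree bounds

  record DegreeBelow (d : ℕ) (P : Poly) : Set where
    constructor degreeBelow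
    field vanishes : ∀ i → d ≤ i → coeff P i ≡ 0#
  open DegreeBelow

  degreeBelow-length : ∀ P → DegreeBelow (length P) P
  degreeBelow-length []      = degreeBelow λ _ _ → refl
  degreeBelow-length (a ∷ P) =
    degreeBelow λ { zero () ; (suc i) (s≤s l≤i) → vanishes (degreeBelow-length P) i l≤i }

  degreeBelow-resp-≈ : ∀ {d P P′} → P ≈ P′ → DegreeBelow d P → DegreeBelow d P′
  degreeBelow-resp-≈ P≈P′ P<d = degreeBelow λ i d≤i → trans (sym (at P≈P′ i)) (vanishes P<d i d≤i)

  degreeBelow-tail : ∀ {d a P} → DegreeBelow (suc d) (a ∷ P) → DegreeBelow d P
  degreeBelow-tail aP<d = degreeBelow λ i d≤i → vanishes aP<d (suc i) (s≤s d≤i)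

  degreeBelow-zero : ∀ {P} → DegreeBelow 0 P → IsZero P
  degreeBelow-zero P<0 = coeffwise λ i → vanishes P<0 i z≤n

  degreeBelow-scale : ∀ {d} a P → DegreeBelow d P → DegreeBelow d (scale a P)
  degreeBelow-scale a P P<d =
    degreeBelow λ i d≤i → trans (coeff-scale a P i) (trans (cong (a *_) (vanishes P<d i d≤i)) (zeroʳ a))

  zero⊎leading : ∀ d P → DegreeBelow d P →
                 IsZero P ⊎ ∃[ e ] e < d × coeff P e ≢ 0# × DegreeBelow (suc e) P
  zero⊎leading zero    P P<0 = inj₁ (degreeBelow-zero P<0)
  zero⊎leading (suc d) P P<d with coeff P d ≟ 0#
  ... | no  Pd≢0 = inj₂ (d , ℕP.≤-refl , Pd≢0 , P<d)
  ... | yes Pd≡0 with zero⊎leading d P (degreeBelow below)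
    where
    below : ∀ i → d ≤ i → coeff P i ≡ 0#
    below i d≤i with ℕP.m≤n⇒m<n∨m≡n d≤i
    ... | inj₁ d<i  = vanishes P<d i d<i
    ... | inj₂ refl = Pd≡0
  ...   | inj₁ P≈0                 = inj₁ P≈0
  ...   | inj₂ (e , e<d , rest) = inj₂ (e , ℕP.m≤n⇒m≤1+n e<d , rest)

  pmul-leading : ∀ a b P Q → DegreeBelow (suc a) P → DegreeBelow (suc b) Q →
                 DegreeBelow (suc (a ℕ.+ b)) (pmul P Q) × coeff (pmul P Q) (a ℕ.+ b) ≡ coeff P a * coeff Q b
  pmul-leading a       b []      Q P<a Q<b = degreeBelow (λ _ _ → refl) , sym (zeroˡ _)
  pmul-leading zero    b (p ∷ P) Q P<1 Q<b =
    degreeBelow-resp-≈ (≈-sym pQ≈) (degreeBelow-scale p Q Q<b) , trans (at pQ≈ b) (coeff-scale p Q b)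
    where
    pQ≈ : pmul (p ∷ P) Q ≈ scale p Q
    pQ≈ = padd-identityʳ (scale p Q) (0∷-zero (pmul-zeroˡ Q (degreeBelow-zero (degreeBelow-tail P<1))))
  pmul-leading (suc a) b (p ∷ P) Q P<a Q<b =
    degreeBelow (λ { zero () ; (suc i) (s≤s a+b<i) → shifted i (ℕP.<⇒≤ a+b<i) (vanishes (proj₁ ih) i a+b<i) })
    , shifted (a ℕ.+ b) ℕP.≤-refl (proj₂ ih)
    where
    ih = pmul-leading a b P Q (degreeBelow-tail P<a) Q<b
    shifted : ∀ i {c} → a ℕ.+ b ≤ i → coeff (pmul P Q) i ≡ c → coeff (pmul (p ∷ P) Q) (suc i) ≡ c
    shifted i a+b≤i PQi≡c = begin
      coeff (pmul (p ∷ P) Q) (suc i)  ≡⟨ coeff-pmul-∷ p P Q (suc i) ⟩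
      p * coeff Q (suc i) + coeff (pmul P Q) i
        ≡⟨ cong₂ _+_ (cong (p *_) (vanishes Q<b (suc i) (s≤s (ℕP.≤-trans (ℕP.m≤n+m b a) a+b≤i)))) PQi≡c ⟩
      p * 0# + _                      ≡⟨ cong (_+ _) (zeroʳ p) ⟩
      0# + _                          ≡⟨ +-identityˡ _ ⟩
      _                               ∎
      where open ≡-Reasoning

  ≈∧length⇒≡ : ∀ f g → length f ≡ length g → f ≈ g → f ≡ g
  ≈∧length⇒≡ []      []      _   _   = refl
  ≈∧length⇒≡ (a ∷ f) (b ∷ g) |f|≡|g| f≈g =
    cong₂ _∷_ (at f≈g zero) (≈∧length⇒≡ f g (ℕP.suc-injective |f|≡|g|) (∷-injective f≈g))

  length-padd : ∀ f g → length (padd f g) ≡ length f ⊔ length g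
  length-padd []      g       = refl
  length-padd (a ∷ f) []      = refl
  length-padd (a ∷ f) (b ∷ g) = cong suc (length-padd f g)

  length-pmul : ∀ a f b g → length (pmul (a ∷ f) (b ∷ g)) ≡ suc (length f ℕ.+ length g)
  length-pmul a [] b g = begin
    length (padd (scale a (b ∷ g)) (0# ∷ []))  ≡⟨ length-padd (scale a (b ∷ g)) (0# ∷ []) ⟩
    length (scale a (b ∷ g)) ⊔ 1               ≡⟨ cong (_⊔ 1) (LP.length-map (a *_) (b ∷ g)) ⟩
    suc (length g) ⊔ 1                         ≡⟨ ℕP.m≥n⇒m⊔n≡m (s≤s z≤n) ⟩
    suc (length g)                             ∎
    where open ≡-Reasoning
  length-pmul a (c ∷ f) b g = begin
    length (padd (scale a (b ∷ g)) (0# ∷ pmul (c ∷ f) (b ∷ g)))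
      ≡⟨ length-padd (scale a (b ∷ g)) (0# ∷ pmul (c ∷ f) (b ∷ g)) ⟩
    length (scale a (b ∷ g)) ⊔ suc (length (pmul (c ∷ f) (b ∷ g)))
      ≡⟨ cong₂ _⊔_ (LP.length-map (a *_) (b ∷ g)) (cong suc (length-pmul c f b g)) ⟩
    suc (length g) ⊔ suc (suc (length f ℕ.+ length g))
      ≡⟨ ℕP.m≤n⇒m⊔n≡n (s≤s (ℕP.m≤n⇒m≤1+n (ℕP.m≤n+m (length g) (length f)))) ⟩
    suc (suc (length f ℕ.+ length g)) ∎
    where open ≡-Reasoning

  -- Monic polynomials

  length-toPoly : ∀ {d} (G : Monic d) → length (toPoly G) ≡ suc d
  length-toPoly []      = refl
  length-toPoly (x ∷ G) = cong suc (length-toPoly G)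

  coeff-toPoly-top : ∀ {d} (G : Monic d) → coeff (toPoly G) d ≡ 1#
  coeff-toPoly-top []      = refl
  coeff-toPoly-top (x ∷ G) = coeff-toPoly-top G

  degreeBelow-toPoly : ∀ {d} (G : Monic d) → DegreeBelow (suc d) (toPoly G)
  degreeBelow-toPoly G = subst (λ l → DegreeBelow l (toPoly G)) (length-toPoly G) (degreeBelow-length (toPoly G))

  toPoly-injective : ∀ {d} (G G′ : Monic d) → toPoly G ≈ toPoly G′ → G ≡ G′
  toPoly-injective []      []        _    = refl
  toPoly-injective (x ∷ G) (x′ ∷ G′) G≈G′ = cong₂ _∷_ (at G≈G′ zero) (toPoly-injective G G′ (∷-injective G≈G′))

  1≢0 : 1# ≢ 0#
  1≢0 1≡0 = 0≢1 (sym 1≡0)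

  monic-degree-unique : ∀ {a b} (A : Monic a) (B : Monic b) → toPoly A ≈ toPoly B → a ≡ b
  monic-degree-unique {a} {b} A B A≈B with ℕP.<-cmp a b
  ... | tri≈ _ a≡b _ = a≡b
  ... | tri< a<b _ _ =
    ⊥-elim (1≢0 (trans (sym (coeff-toPoly-top B)) (trans (sym (at A≈B b)) (vanishes (degreeBelow-toPoly A) b a<b))))
  ... | tri> _ _ b<a =
    ⊥-elim (1≢0 (trans (sym (coeff-toPoly-top A)) (trans (at A≈B a) (vanishes (degreeBelow-toPoly B) a b<a))))

  fromPoly : ∀ e → Poly → Monic e
  fromPoly e P = Vec.tabulate (λ j → coeff P (toℕ j))

  toPoly-fromPoly : ∀ e P → DegreeBelow (suc e) P → coeff P e ≡ 1# → toPoly (fromPoly e P) ≈ P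
  toPoly-fromPoly zero    P       P<1 P₀≡1 =
    coeffwise λ { zero → sym P₀≡1 ; (suc i) → sym (vanishes P<1 (suc i) (s≤s z≤n)) }
  toPoly-fromPoly (suc e) []      _   0≡1  = ⊥-elim (0≢1 0≡1)
  toPoly-fromPoly (suc e) (p ∷ P) P<e Pₑ≡1 = ∷-cong refl (toPoly-fromPoly e P (degreeBelow-tail P<e) Pₑ≡1)

  pmul-monic-leading : ∀ {d} (G : Monic d) e Q → DegreeBelow (suc e) Q →
                       DegreeBelow (suc (d ℕ.+ e)) (pmul (toPoly G) Q) × coeff (pmul (toPoly G) Q) (d ℕ.+ e) ≡ coeff Q e
  pmul-monic-leading {d} G e Q Q<e with pmul-leading d e (toPoly G) Q (degreeBelow-toPoly G) Q<e
  ... | GQ<d+e , top≡ = GQ<d+e , trans top≡ (trans (cong (_* coeff Q e) (coeff-toPoly-top G)) (*-identityˡ _))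

  infixl 7 _*ₘ_
  _*ₘ_ : ∀ {a b} → Monic a → Monic b → Monic (a ℕ.+ b)
  _*ₘ_ {a} {b} G H = fromPoly (a ℕ.+ b) (pmul (toPoly G) (toPoly H))

  toPoly-*ₘ : ∀ {a b} (G : Monic a) (H : Monic b) → toPoly (G *ₘ H) ≈ pmul (toPoly G) (toPoly H)
  toPoly-*ₘ {a} {b} G H with pmul-monic-leading G b (toPoly H) (degreeBelow-toPoly H)
  ... | GH<a+b , top≡ = toPoly-fromPoly (a ℕ.+ b) _ GH<a+b (trans top≡ (coeff-toPoly-top H))

  length-pmul-toPoly : ∀ {d e} (G : Monic d) (H : Monic e) → length (pmul (toPoly G) (toPoly H)) ≡ suc (d ℕ.+ e)
  length-pmul-toPoly G H with toPoly G | length-toPoly G | toPoly H | length-toPoly H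
  ... | a ∷ f | refl | b ∷ g | refl = length-pmul a f b g

  divMod : ∀ {d} (G : Monic d) P → ∃[ Q ] ∃[ R ] P ≈ padd (pmul (toPoly G) Q) R × DegreeBelow d R
  divMod G [] =
    [] , [] , ≈-sym (≈-trans (padd-identityʳ _ ≈-refl) (pmul-zeroʳ (toPoly G))) , degreeBelow λ _ _ → refl
  divMod {d} G (a ∷ P) with divMod G P
  ... | Q , R , P≈GQ+R , R<d = padd (0# ∷ Q) (c ∷ []) , R′ , a∷P≈ , R′<d
    where
    M = toPoly G
    c = coeff (a ∷ R) d
    R′ = padd (a ∷ R) (scale (- c) M)
    a∷P≈ : a ∷ P ≈ padd (pmul M (padd (0# ∷ Q) (c ∷ []))) R′
    a∷P≈ = ≈-sym (begin
      padd (pmul M (padd (0# ∷ Q) (c ∷ []))) R′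
        ≈⟨ padd-cong (≈-trans (pmul-distribˡ M (0# ∷ Q) (c ∷ [])) (padd-cong (pmul-0∷ʳ M Q) (pmul-constʳ M c))) ≈-refl ⟩
      padd (padd (0# ∷ pmul M Q) (scale c M)) (padd (a ∷ R) (scale (- c) M))
        ≈⟨ padd-interchange (0# ∷ pmul M Q) (scale c M) (a ∷ R) (scale (- c) M) ⟩
      padd (padd (0# ∷ pmul M Q) (a ∷ R)) (padd (scale c M) (scale (- c) M))
        ≈⟨ padd-identityʳ _ (scale-inverse c M) ⟩
      (0# + a) ∷ padd (pmul M Q) R
        ≈⟨ ∷-cong (+-identityˡ a) (≈-sym P≈GQ+R) ⟩
      a ∷ P ∎)
      where open ≈-Reasoning
    a∷R<1+d : DegreeBelow (suc d) (a ∷ R)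
    a∷R<1+d = degreeBelow λ { zero () ; (suc i) (s≤s d≤i) → vanishes R<d i d≤i }
    R′<d : DegreeBelow d R′
    R′<d = degreeBelow λ i d≤i → trans (coeff-padd (a ∷ R) (scale (- c) M) i)
                                   (trans (cong (coeff (a ∷ R) i +_) (coeff-scale (- c) M i)) (top i d≤i))
      where
      -- c was chosen to cancel the leading coefficient of a ∷ R.
      top : ∀ i → d ≤ i → coeff (a ∷ R) i + (- c) * coeff M i ≡ 0#
      top i d≤i with ℕP.m≤n⇒m<n∨m≡n d≤i
      ... | inj₁ d<i  = trans (cong₂ _+_ (vanishes a∷R<1+d i d<i)
                                         (trans (cong ((- c) *_) (vanishes (degreeBelow-toPoly G) i d<i)) (zeroʳ _)))
                              (+-identityˡ _)
      ... | inj₂ refl = trans (cong (c +_) (trans (cong ((- c) *_) (coeff-toPoly-top G)) (*-identityʳ _))) (-‿inverseʳ c)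

  monic-noZeroDivisor : ∀ {d} (G : Monic d) Z → IsZero (pmul (toPoly G) Z) → IsZero Z
  monic-noZeroDivisor {d} G Z GZ≈0 with zero⊎leading (length Z) Z (degreeBelow-length Z)
  ... | inj₁ Z≈0                   = Z≈0
  ... | inj₂ (e , _ , Zₑ≢0 , Z<e) =
    ⊥-elim (Zₑ≢0 (trans (sym (proj₂ (pmul-monic-leading G e Z Z<e))) (at GZ≈0 (d ℕ.+ e))))

  pmul-cancelˡ : ∀ {d} (G : Monic d) X Y → pmul (toPoly G) X ≈ pmul (toPoly G) Y → X ≈ Y
  pmul-cancelˡ G X Y GX≈GY = coeffwise λ i → x∙y⁻¹≈ε⇒x≈y _ _ (begin
    coeff X i + - coeff Y i              ≡⟨ cong (coeff X i +_) (sym (trans (coeff-scale (- 1#) Y i) (-1*x≈-x _))) ⟩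
    coeff X i + coeff (neg Y) i          ≡⟨ sym (coeff-padd X (neg Y) i) ⟩
    coeff (padd X (neg Y)) i             ≡⟨ at (monic-noZeroDivisor G (padd X (neg Y)) G[X-Y]≈0) i ⟩
    0#                                   ∎)
    where
    open ≡-Reasoning
    M = toPoly G
    G[X-Y]≈0 : IsZero (pmul M (padd X (neg Y)))
    G[X-Y]≈0 = ≈-trans (pmul-distribˡ M X (neg Y))
                 (≈-trans (padd-cong GX≈GY (pmul-scaleʳ (- 1#) M Y)) (padd-inverseʳ (pmul M Y)))

  -- Divisibility and Gauss's lemma

  infix 4 _∣ₚ_
  record _∣ₚ_ (A P : Poly) : Set where
    constructor divides
    field
      quotient : Poly
      equation : pmul A quotient ≈ P

  ∣ₚ-respʳ : ∀ {A P P′} → P ≈ P′ → A ∣ₚ P → A ∣ₚ P′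
  ∣ₚ-respʳ P≈P′ (divides Q AQ≈P) = divides Q (≈-trans AQ≈P P≈P′)

  ∣ₚ-respˡ : ∀ {A A′ P} → A ≈ A′ → A ∣ₚ P → A′ ∣ₚ P
  ∣ₚ-respˡ A≈A′ (divides Q AQ≈P) = divides Q (≈-trans (pmul-congˡ Q (≈-sym A≈A′)) AQ≈P)

  ∣ₚ-refl : ∀ A → A ∣ₚ A
  ∣ₚ-refl A = divides (1# ∷ []) (pmul-identityʳ A)

  ∣ₚ-pmulʳ : ∀ {A P} X → A ∣ₚ P → A ∣ₚ pmul P X
  ∣ₚ-pmulʳ {A} X (divides Q AQ≈P) = divides (pmul Q X) (≈-trans (≈-sym (pmul-assoc A Q X)) (pmul-congˡ X AQ≈P))

  ∣ₚ-trans : ∀ {A B C} → A ∣ₚ B → B ∣ₚ C → A ∣ₚ C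
  ∣ₚ-trans A∣B (divides Q BQ≈C) = ∣ₚ-respʳ BQ≈C (∣ₚ-pmulʳ Q A∣B)

  ∣ₚ-padd : ∀ {A P P′} → A ∣ₚ P → A ∣ₚ P′ → A ∣ₚ padd P P′
  ∣ₚ-padd {A} (divides Q AQ≈P) (divides Q′ AQ′≈P′) =
    divides (padd Q Q′) (≈-trans (pmul-distribˡ A Q Q′) (padd-cong AQ≈P AQ′≈P′))

  pmul-∣ₚ : ∀ {A B} X → A ∣ₚ B → pmul A X ∣ₚ pmul B X
  pmul-∣ₚ {A} {B} X (divides Q AQ≈B) = divides Q (begin
    pmul (pmul A X) Q   ≈⟨ pmul-assoc A X Q ⟩
    pmul A (pmul X Q)   ≈⟨ pmul-congʳ A (pmul-comm X Q) ⟩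
    pmul A (pmul Q X)   ≈⟨ ≈-sym (pmul-assoc A Q X) ⟩
    pmul (pmul A Q) X   ≈⟨ pmul-congˡ X AQ≈B ⟩
    pmul B X            ∎)
    where open ≈-Reasoning

  ∣⇒∣ₚ : ∀ {d k} (G : Monic d) (F : Monic k) → G ∣ F → toPoly G ∣ₚ toPoly F
  ∣⇒∣ₚ G F (j , H , GH≡F) = divides (toPoly H) (≡⇒≈ GH≡F)

  ∣ₚ⇒∣ : ∀ {d k} (G : Monic d) (F : Monic k) → toPoly G ∣ₚ toPoly F → G ∣ F
  ∣ₚ⇒∣ {d} {k} G F (divides Q GQ≈F) with zero⊎leading (length Q) Q (degreeBelow-length Q)
  ... | inj₁ Q≈0 =
    ⊥-elim (0≢1 (trans (sym (at (≈-trans (pmul-congʳ (toPoly G) Q≈0) (pmul-zeroʳ (toPoly G))) k))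
                       (trans (at GQ≈F k) (coeff-toPoly-top F))))
  ... | inj₂ (e , _ , Qₑ≢0 , Q<e) with pmul-monic-leading G e Q Q<e | ℕP.<-cmp (d ℕ.+ e) k
  ...   | GQ<d+e , _ | tri< d+e<k _ _ =
    ⊥-elim (0≢1 (trans (sym (vanishes GQ<d+e k d+e<k)) (trans (at GQ≈F k) (coeff-toPoly-top F))))
  ...   | _ , top≡ | tri> _ _ k<d+e =
    ⊥-elim (Qₑ≢0 (trans (sym top≡) (trans (at GQ≈F (d ℕ.+ e)) (vanishes (degreeBelow-toPoly F) (d ℕ.+ e) k<d+e))))
  ...   | _ , top≡ | tri≈ _ refl _ = e , H , ≈∧length⇒≡ _ _ (trans (length-pmul-toPoly G H) (sym (length-toPoly F))) GH≈F
    where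
    H = fromPoly e Q
    GH≈F : pmul (toPoly G) (toPoly H) ≈ toPoly F
    GH≈F = ≈-trans (pmul-congʳ (toPoly G) (toPoly-fromPoly e Q Q<e Qₑ≡1)) GQ≈F
      where Qₑ≡1 = trans (sym top≡) (trans (at GQ≈F k) (coeff-toPoly-top F))

  ∣-degree : ∀ {d k} (G : Monic d) (F : Monic k) → G ∣ F → ∃[ j ] d ℕ.+ j ≡ k
  ∣-degree G F (j , H , GH≡F) =
    j , ℕP.suc-injective (trans (sym (length-pmul-toPoly G H)) (trans (cong length GH≡F) (length-toPoly F)))

  ∣⇒≤ : ∀ {d k} (G : Monic d) (F : Monic k) → G ∣ F → d ≤ k
  ∣⇒≤ G F G∣F with ∣-degree G F G∣F
  ... | j , d+j≡k = subst (_ ≤_) d+j≡k (ℕP.m≤m+n _ j)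

  ∣-trans : ∀ {a b c} (A : Monic a) (B : Monic b) (C : Monic c) → A ∣ B → B ∣ C → A ∣ C
  ∣-trans A B C A∣B B∣C = ∣ₚ⇒∣ A C (∣ₚ-trans (∣⇒∣ₚ A B A∣B) (∣⇒∣ₚ B C B∣C))

  1∣ : ∀ {k} (F : Monic k) → [] ∣ F
  1∣ F = ∣ₚ⇒∣ [] F (divides (toPoly F) (pmul-identityˡ (toPoly F)))

  ∣-refl : ∀ {k} (F : Monic k) → F ∣ F
  ∣-refl F = ∣ₚ⇒∣ F F (∣ₚ-refl (toPoly F))

  ∣-*ₘʳ : ∀ {a b c} (E : Monic a) (G : Monic b) (D : Monic c) → E ∣ G → E ∣ (G *ₘ D)
  ∣-*ₘʳ E G D E∣G = ∣ₚ⇒∣ E (G *ₘ D) (∣ₚ-respʳ (≈-sym (toPoly-*ₘ G D)) (∣ₚ-pmulʳ (toPoly D) (∣⇒∣ₚ E G E∣G)))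

  ∣-*ₘˡ : ∀ {b c} (G : Monic b) (D : Monic c) → D ∣ (G *ₘ D)
  ∣-*ₘˡ G D = ∣ₚ⇒∣ D (G *ₘ D) (divides (toPoly G) (≈-trans (pmul-comm (toPoly D) (toPoly G)) (≈-sym (toPoly-*ₘ G D))))

  *ₘ-∣ : ∀ {a b c} (E : Monic a) (G : Monic b) (D : Monic c) → E ∣ G → (E *ₘ D) ∣ (G *ₘ D)
  *ₘ-∣ E G D E∣G = ∣ₚ⇒∣ (E *ₘ D) (G *ₘ D)
    (∣ₚ-respˡ (≈-sym (toPoly-*ₘ E D)) (∣ₚ-respʳ (≈-sym (toPoly-*ₘ G D)) (pmul-∣ₚ (toPoly D) (∣⇒∣ₚ E G E∣G))))

  Coprime : ∀ {a c} → Monic a → Monic c → Set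
  Coprime A C = ∀ d (D : Monic d) → D ∣ A → D ∣ C → d ≡ 0

  record Ideal (S : Poly → Set) : Set where
    field
      resp-≈      : ∀ {P P′} → P ≈ P′ → S P → S P′
      padd-closed : ∀ {P P′} → S P → S P′ → S (padd P P′)
      pmul-closed : ∀ {P} X → S P → S (pmul P X)

    scale-closed : ∀ {P} c → S P → S (scale c P)
    scale-closed {P} c P∈S = resp-≈ (pmul-constʳ P c) (pmul-closed (c ∷ []) P∈S)

  module _ {S : Poly → Set} (ideal : Ideal S) where
    open Ideal ideal

    -- Euclid's step: the remainder of Y modulo X lies in S.
    divides⊎smaller : ∀ {e y} (X : Monic e) (Y : Monic y) → S (toPoly X) → S (toPoly Y) →
                      toPoly X ∣ₚ toPoly Y ⊎ ∃[ e′ ] e′ < e × Σ (Monic e′) (λ X′ → S (toPoly X′))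
    divides⊎smaller {e} X Y X∈S Y∈S with divMod X (toPoly Y)
    ... | Q , R , Y≈XQ+R , R<e with zero⊎leading e R R<e
    ...   | inj₁ R≈0 = inj₁ (divides Q (≈-sym (≈-trans Y≈XQ+R (padd-identityʳ _ R≈0))))
    ...   | inj₂ (e′ , e′<e , Rₑ′≢0 , R<e′) with inverse (coeff R e′) Rₑ′≢0
    ...     | r , Rₑ′r≡1 = inj₂ (e′ , e′<e , fromPoly e′ (scale r R) , resp-≈ (≈-sym monic) (scale-closed r R∈S))
      where
      R∈S : S R
      R∈S = resp-≈ (≈-sym (padd-solve Y≈XQ+R)) (padd-closed Y∈S (scale-closed (- 1#) (pmul-closed Q X∈S)))
      monic : toPoly (fromPoly e′ (scale r R)) ≈ scale r R
      monic = toPoly-fromPoly e′ (scale r R) (degreeBelow-scale r R R<e′)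
                (trans (coeff-scale r R e′) (trans (*-comm r _) Rₑ′r≡1))

    coprime⇒unit∈ : ∀ {a c} (A : Monic a) (C : Monic c) → Coprime A C →
                    S (toPoly A) → S (toPoly C) → S (1# ∷ [])
    coprime⇒unit∈ {a} A C coprime A∈S C∈S = descend (suc a) A ℕP.≤-refl A∈S
      where
      descend : ∀ n {e} (X : Monic e) → e < n → S (toPoly X) → S (1# ∷ [])
      descend (suc n) X (s≤s e≤n) X∈S with divides⊎smaller X A X∈S A∈S | divides⊎smaller X C X∈S C∈S
      ... | inj₂ (e′ , e′<e , X′ , X′∈S) | _ = descend n X′ (ℕP.<-≤-trans e′<e e≤n) X′∈S
      ... | inj₁ _ | inj₂ (e′ , e′<e , X′ , X′∈S) = descend n X′ (ℕP.<-≤-trans e′<e e≤n) X′∈S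
      ... | inj₁ X∣A | inj₁ X∣C with coprime _ X (∣ₚ⇒∣ X A X∣A) (∣ₚ⇒∣ X C X∣C)
      ...   | refl with X
      ...     | [] = X∈S

  gauss : ∀ {a c} (A : Monic a) (C : Monic c) B → Coprime A C →
          toPoly A ∣ₚ pmul B (toPoly C) → toPoly A ∣ₚ B
  gauss A C B coprime A∣BC =
    ∣ₚ-respʳ (≈-trans (pmul-comm B (1# ∷ [])) (pmul-identityˡ B)) (coprime⇒unit∈ ideal A C coprime A∣BA A∣BC)
    where
    ideal : Ideal (λ X → toPoly A ∣ₚ pmul B X)
    ideal = record
      { resp-≈      = λ X≈X′ → ∣ₚ-respʳ (pmul-congʳ B X≈X′)
      ; padd-closed = λ {X} {X′} A∣BX A∣BX′ → ∣ₚ-respʳ (≈-sym (pmul-distribˡ B X X′)) (∣ₚ-padd A∣BX A∣BX′)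
      ; pmul-closed = λ {X} Y A∣BX → ∣ₚ-respʳ (pmul-assoc B X Y) (∣ₚ-pmulʳ Y A∣BX)
      }
    A∣BA : toPoly A ∣ₚ pmul B (toPoly A)
    A∣BA = divides B (pmul-comm (toPoly A) B)

  -- Splitting a monic polynomial into a gap-free and a rough part

  noGaps⇒bridged : ∀ {m k} (G : Monic k) → NoGaps m G → Bridged m k (IsDivDeg G)
  noGaps⇒bridged G = gapFree⇒bridged ([] , 1∣ G) (G , ∣-refl G)

  bridged⇒noGaps : ∀ {m k} (F : Monic k) → Bridged m k (IsDivDeg F) → NoGaps m F
  bridged⇒noGaps F = bridged⇒gapFree (λ s (E , E∣F) → ∣⇒≤ E F E∣F)

  noGaps-1 : ∀ m → NoGaps m []
  noGaps-1 m a b _ (B , B∣1) a<b _ = ⊥-elim (ℕP.n≮0 (ℕP.<-≤-trans (ℕP.≤-<-trans z≤n a<b) (∣⇒≤ B [] B∣1)))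

  noGaps-*ₘ : ∀ {m k p} (G : Monic k) (D : Monic p) → p ≤ k ℕ.+ m → NoGaps m G → NoGaps m (G *ₘ D)
  noGaps-*ₘ G D p≤k+m noGapsG = bridged⇒noGaps (G *ₘ D)
    (bridged-shift p≤k+m (λ (E , E∣G) → E , ∣-*ₘʳ E G D E∣G) (D , ∣-*ₘˡ G D) (λ (E , E∣G) → E *ₘ D , *ₘ-∣ E G D E∣G)
                   (noGaps⇒bridged G noGapsG))

  rough-divisor : ∀ {t j d} {H : Monic j} → Rough t H → (D : Monic d) → D ∣ H → d ≡ 0 ⊎ t < d
  rough-divisor {d = zero}  rough D D∣H = inj₁ refl
  rough-divisor {d = suc d} rough D D∣H = inj₂ (rough (suc d) D D∣H (s≤s z≤n))

  rough-∣ : ∀ {t j b} {H : Monic j} (B : Monic b) → B ∣ H → Rough t H → Rough t B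
  rough-∣ {H = H} B B∣H rough d D D∣B = rough d D (∣-trans D B H D∣B B∣H)

  rough⇒coprime : ∀ {t j d} {H : Monic j} → Rough t H → d ≤ t → (D : Monic d) → Coprime D H
  rough⇒coprime rough d≤t D e E E∣D E∣H with rough-divisor rough E E∣H
  ... | inj₁ e≡0 = e≡0
  ... | inj₂ t<e = ⊥-elim (ℕP.<-irrefl refl (ℕP.≤-<-trans (ℕP.≤-trans (∣⇒≤ E D E∣D) d≤t) t<e))

  record Split (m : ℕ) (P : Poly) : Set where
    constructor split
    field
      {k j}    : ℕ
      G        : Monic k
      H        : Monic j
      G-noGaps : NoGaps m G
      H-rough  : Rough (k ℕ.+ m) H
      GH≈P     : pmul (toPoly G) (toPoly H) ≈ P

  split-resp-≈ : ∀ {m P P′} → P ≈ P′ → Split m P → Split m P′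
  split-resp-≈ P≈P′ (split G H G-noGaps H-rough GH≈P) = split G H G-noGaps H-rough (≈-trans GH≈P P≈P′)

  module _ (m : ℕ) where

    SmallDivisor : ℕ → ∀ {j} → Monic j → Set
    SmallDivisor t H = ∃[ d ] Σ (Monic d) λ D → D ∣ H × 1 ≤ d × d ≤ t

    noSmallDivisor⇒rough : ∀ {t j} (H : Monic j) → ¬ SmallDivisor t H → Rough t H
    noSmallDivisor⇒rough {t} H none d D D∣H 1≤d with t <? d
    ... | yes t<d = t<d
    ... | no  t≮d = ⊥-elim (none (d , D , D∣H , 1≤d , ℕP.≮⇒≥ t≮d))

    -- Move small divisors of H into G as long as there are any.
    split-extend : ∀ N {j} (H : Monic j) → j < N → ∀ {k} (G : Monic k) → NoGaps m G →
                   ¬ ¬ Split m (pmul (toPoly G) (toPoly H))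
    split-extend (suc N) {j} H (s≤s j≤N) {k} G noGapsG = ¬¬-excluded-middle >>= extend
      where
      extend : Dec (SmallDivisor (k ℕ.+ m) H) → ¬ ¬ Split m (pmul (toPoly G) (toPoly H))
      extend (no none) = pure (split G H noGapsG (noSmallDivisor⇒rough H none) ≈-refl)
      extend (yes (d , D , (j′ , H′ , DH′≡H) , 1≤d , d≤k+m)) =
        ¬¬-map (split-resp-≈ regroup) (split-extend N H′ j′<N (G *ₘ D) (noGaps-*ₘ G D d≤k+m noGapsG))
        where
        j′<N : j′ < N
        j′<N = ℕP.<-≤-trans (subst (j′ <_) (proj₂ (∣-degree D H (j′ , H′ , DH′≡H))) (ℕP.m<n+m j′ 1≤d)) j≤N
        regroup : pmul (toPoly (G *ₘ D)) (toPoly H′) ≈ pmul (toPoly G) (toPoly H)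
        regroup = begin
          pmul (toPoly (G *ₘ D)) (toPoly H′)             ≈⟨ pmul-congˡ (toPoly H′) (toPoly-*ₘ G D) ⟩
          pmul (pmul (toPoly G) (toPoly D)) (toPoly H′)  ≈⟨ pmul-assoc (toPoly G) (toPoly D) (toPoly H′) ⟩
          pmul (toPoly G) (pmul (toPoly D) (toPoly H′))  ≈⟨ pmul-congʳ (toPoly G) (≡⇒≈ DH′≡H) ⟩
          pmul (toPoly G) (toPoly H)                     ∎
          where open ≈-Reasoning

    split-exists : ∀ {n} (F : Monic n) → ¬ ¬ Split m (toPoly F)
    split-exists {n} F =
      ¬¬-map (split-resp-≈ (pmul-identityˡ (toPoly F))) (split-extend (suc n) F ℕP.≤-refl [] (noGaps-1 m))

    split-G-unique≤ : ∀ {P} (s s′ : Split m P) → Split.k s ≤ Split.k s′ → toPoly (Split.G s) ≈ toPoly (Split.G s′)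
    split-G-unique≤ {P} (split {k} G H _ H-rough GH≈P) (split {k′} G′ H′ G′-noGaps H′-rough G′H′≈P) k≤k′
      with ∣ₚ⇒∣ G G′ (gauss G H′ (toPoly G′) (rough⇒coprime H′-rough (ℕP.m≤n⇒m≤n+o m k≤k′) G) G∣G′H′)
      where
      G∣G′H′ : toPoly G ∣ₚ pmul (toPoly G′) (toPoly H′)
      G∣G′H′ = divides (toPoly H) (≈-trans GH≈P (≈-sym G′H′≈P))
    ... | zero  , [] , G1≡G′ = ≈-trans (≈-sym (pmul-identityʳ (toPoly G))) (≡⇒≈ G1≡G′)
    ... | suc _ , B  , GB≡G′ = ⊥-elim (noGaps⇒bridged G′ G′-noGaps k k<k′ noDivisorAbove)
      where
      k<k′ : k < k′
      k<k′ = subst (k <_) (proj₂ (∣-degree G G′ (_ , B , GB≡G′))) (ℕP.m<m+n k (s≤s z≤n))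
      B∣H : B ∣ H
      B∣H = ∣ₚ⇒∣ B H (divides (toPoly H′) (≈-sym (pmul-cancelˡ G _ _ (begin
        pmul (toPoly G) (toPoly H)                     ≈⟨ GH≈P ⟩
        P                                              ≈⟨ ≈-sym G′H′≈P ⟩
        pmul (toPoly G′) (toPoly H′)                   ≈⟨ pmul-congˡ (toPoly H′) (≡⇒≈ GB≡G′) ⟨
        pmul (pmul (toPoly G) (toPoly B)) (toPoly H′)  ≈⟨ pmul-assoc (toPoly G) (toPoly B) (toPoly H′) ⟩
        pmul (toPoly G) (pmul (toPoly B) (toPoly H′))  ∎))))
        where open ≈-Reasoning
      -- A divisor of G′ of degree in (k, k + m] is coprime to B, hence divides G.
      noDivisorAbove : ¬ (∃[ s ] IsDivDeg G′ s × k < s × s ≤ k ℕ.+ m)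
      noDivisorAbove (s , (D , D∣G′) , k<s , s≤k+m) = ℕP.<⇒≱ k<s (∣⇒≤ D G D∣G)
        where
        D∣G : D ∣ G
        D∣G = ∣ₚ⇒∣ D G (gauss D B (toPoly G) (rough⇒coprime (rough-∣ B B∣H H-rough) s≤k+m D)
                                            (∣ₚ-respʳ (≈-sym (≡⇒≈ GB≡G′)) (∣⇒∣ₚ D G′ D∣G′)))

    split-H-unique : ∀ {P} (s s′ : Split m P) → toPoly (Split.G s) ≈ toPoly (Split.G s′) →
                     toPoly (Split.H s) ≈ toPoly (Split.H s′)
    split-H-unique (split G H _ _ GH≈P) (split G′ H′ _ _ G′H′≈P) G≈G′ =
      pmul-cancelˡ G _ _ (≈-trans GH≈P (≈-trans (≈-sym G′H′≈P) (pmul-congˡ (toPoly H′) (≈-sym G≈G′))))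

    split-unique : ∀ {P} (s s′ : Split m P) →
                   toPoly (Split.G s) ≈ toPoly (Split.G s′) × toPoly (Split.H s) ≈ toPoly (Split.H s′)
    split-unique s s′ with ℕP.≤-total (Split.k s) (Split.k s′)
    ... | inj₁ k≤k′ = G≈G′ , split-H-unique s s′ G≈G′
      where G≈G′ = split-G-unique≤ s s′ k≤k′
    ... | inj₂ k′≤k = G≈G′ , split-H-unique s s′ G≈G′
      where G≈G′ = ≈-sym (split-G-unique≤ s′ s k′≤k)

  -- Counting

  elements : List Carrier
  elements = map (Inverse.from enum) (allFin q)

  elements-unique : Unique elements
  elements-unique = map-unique _ (UniqueP.allFin⁺ q) λ _ _ → Injection.injective (↔⇒↣ (↔-sym enum))

  elements-complete : ∀ x → x ∈ elements
  elements-complete x =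
    subst (_∈ elements) (Inverse.strictlyInverseʳ enum x) (∈-map⁺ (Inverse.from enum) (∈-allFin (Inverse.to enum x)))

  elements-length : length elements ≡ q
  elements-length = trans (LP.length-map _ (allFin q)) (LP.length-tabulate _)

  monics : ∀ n → List (Monic n)
  monics zero    = [] ∷ []
  monics (suc n) = map (uncurry _∷_) (cartesianProduct elements (monics n))

  monics-unique : ∀ n → Unique (monics n)
  monics-unique zero    = All.[] ∷ []
  monics-unique (suc n) = map-unique _ (UniqueP.cartesianProduct⁺ elements-unique (monics-unique n))
    λ _ _ x∷xs≡y∷ys → cong₂ _,_ (VecP.∷-injectiveˡ x∷xs≡y∷ys) (VecP.∷-injectiveʳ x∷xs≡y∷ys)

  monics-complete : ∀ n (F : Monic n) → F ∈ monics n
  monics-complete zero    []      = here refl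
  monics-complete (suc n) (x ∷ F) =
    ∈-map⁺ (uncurry _∷_) (∈-cartesianProduct⁺ (elements-complete x) (monics-complete n F))

  monics-length : ∀ n → length (monics n) ≡ q ^ n
  monics-length zero    = refl
  monics-length (suc n) = begin
    length (monics (suc n))                         ≡⟨ LP.length-map _ (cartesianProduct elements (monics n)) ⟩
    length (cartesianProduct elements (monics n))   ≡⟨ length-cartesianProduct elements (monics n) ⟩
    length elements ℕ.* length (monics n)           ≡⟨ cong₂ ℕ._*_ elements-length (monics-length n) ⟩
    q ℕ.* q ^ n                                     ∎
    where open ≡-Reasoning

  module SplitCount (m n : ℕ) {Nf Nr : ℕ → ℕ}
                    (countF : ∀ k → IsCountOf (NoGaps m {k}) (Nf k))
                    (countR : ∀ k → IsCountOf (Rough (k ℕ.+ m) {n ∸ k}) (Nr k)) where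
    open ≡-Reasoning

    Lf : ∀ k → List (Monic k)
    Lf k = proj₁ (countF k)
    Lf-unique : ∀ k → Unique (Lf k)
    Lf-unique k = proj₁ (proj₂ (countF k))
    Lf-exact : ∀ k (G : Monic k) → G ∈ Lf k ⇔ NoGaps m G
    Lf-exact k = proj₁ (proj₂ (proj₂ (countF k)))
    Lf-length : ∀ k → length (Lf k) ≡ Nf k
    Lf-length k = proj₂ (proj₂ (proj₂ (countF k)))

    Lr : ∀ k → List (Monic (n ∸ k))
    Lr k = proj₁ (countR k)
    Lr-unique : ∀ k → Unique (Lr k)
    Lr-unique k = proj₁ (proj₂ (countR k))
    Lr-exact : ∀ k (H : Monic (n ∸ k)) → H ∈ Lr k ⇔ Rough (k ℕ.+ m) H
    Lr-exact k = proj₁ (proj₂ (proj₂ (countR k)))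
    Lr-length : ∀ k → length (Lr k) ≡ Nr k
    Lr-length k = proj₂ (proj₂ (proj₂ (countR k)))

    pairs : ∀ k → List (Monic k × Monic (n ∸ k))
    pairs k = cartesianProduct (Lf k) (Lr k)
    -- Reading the product as a monic of degree n avoids a cast; it is meaningful only for k ≤ n.
    product : ∀ k → Monic k × Monic (n ∸ k) → Monic n
    product k (G , H) = fromPoly n (pmul (toPoly G) (toPoly H))
    block : ℕ → List (Monic n)
    block k = map (product k) (pairs k)
    splits : List (Monic n)
    splits = concat (applyUpTo block (suc n))

    length-block : ∀ {k} → length (block k) ≡ Nf k ℕ.* Nr k
    length-block {k} = begin
      length (block k)                 ≡⟨ LP.length-map (product k) (pairs k) ⟩
      length (pairs k)                 ≡⟨ length-cartesianProduct (Lf k) (Lr k) ⟩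
      length (Lf k) ℕ.* length (Lr k)  ≡⟨ cong₂ ℕ._*_ (Lf-length k) (Lr-length k) ⟩
      Nf k ℕ.* Nr k                    ∎

    toPoly-product : ∀ {k} → k ≤ n → (G : Monic k) (H : Monic (n ∸ k)) →
                     toPoly (product k (G , H)) ≈ pmul (toPoly G) (toPoly H)
    toPoly-product {k} k≤n G H =
      subst (λ d → toPoly (fromPoly d GH) ≈ GH) (ℕP.m+[n∸m]≡n k≤n) (toPoly-*ₘ G H)
      where GH = pmul (toPoly G) (toPoly H)

    pair⇒split : ∀ {k} → k ≤ n → ∀ {p} → p ∈ pairs k → Split m (toPoly (product k p))
    pair⇒split {k} k≤n {G , H} p∈ = split G H
      (Equivalence.to (Lf-exact k G) (proj₁ (∈-cartesianProduct⁻ (Lf k) (Lr k) p∈)))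
      (Equivalence.to (Lr-exact k H) (proj₂ (∈-cartesianProduct⁻ (Lf k) (Lr k) p∈)))
      (≈-sym (toPoly-product k≤n G H))

    same-split : ∀ {i j} → i ≤ n → j ≤ n → ∀ {p p′} → p ∈ pairs i → p′ ∈ pairs j → product i p ≡ product j p′ →
                 toPoly (proj₁ p) ≈ toPoly (proj₁ p′) × toPoly (proj₂ p) ≈ toPoly (proj₂ p′)
    same-split i≤n j≤n p∈ p′∈ p≡p′ =
      split-unique m (pair⇒split i≤n p∈) (split-resp-≈ (≡⇒≈ (cong toPoly (sym p≡p′))) (pair⇒split j≤n p′∈))

    block-unique : ∀ {k} → k < suc n → Unique (block k)
    block-unique {k} (s≤s k≤n) =
      map-unique (product k) (UniqueP.cartesianProduct⁺ (Lf-unique k) (Lr-unique k))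
        λ {(G , H)} {(G′ , H′)} p∈ p′∈ p≡p′ → let (G≈G′ , H≈H′) = same-split k≤n k≤n p∈ p′∈ p≡p′ in
          cong₂ _,_ (toPoly-injective G G′ G≈G′) (toPoly-injective H H′ H≈H′)

    blocks-disjoint : ∀ {i j} → i < j → j < suc n → Disjoint (block i) (block j)
    blocks-disjoint {i} {j} i<j (s≤s j≤n) (F∈i , F∈j) with ∈-map⁻ (product i) F∈i | ∈-map⁻ (product j) F∈j
    ... | (G , H) , p∈ , F≡ | (G′ , H′) , p′∈ , F≡′ =
      ℕP.<⇒≢ i<j (monic-degree-unique G G′ (proj₁ (same-split i≤n j≤n p∈ p′∈ (trans (sym F≡) F≡′))))
      where i≤n = ℕP.<⇒≤ (ℕP.<-≤-trans i<j j≤n)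

    splits-unique : Unique splits
    splits-unique = UniqueP.concat⁺ (AllP.applyUpTo⁺₁ block (suc n) block-unique)
                                    (AllPairsP.applyUpTo⁺₁ block (suc n) blocks-disjoint)

    member : ∀ (F : Monic n) {k j} (G : Monic k) (H : Monic j) → j ≡ n ∸ k → k ≤ n →
             NoGaps m G → Rough (k ℕ.+ m) H → pmul (toPoly G) (toPoly H) ≈ toPoly F → F ∈ splits
    member F {k} G H refl k≤n G-noGaps H-rough GH≈F =
      ∈-concat⁺′ (subst (_∈ block k) product≡F (∈-map⁺ (product k) (∈-cartesianProduct⁺ G∈ H∈)))
                 (∈-applyUpTo⁺ block (s≤s k≤n))
      where
      G∈ = Equivalence.from (Lf-exact k G) G-noGaps
      H∈ = Equivalence.from (Lr-exact k H) H-rough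
      product≡F : product k (G , H) ≡ F
      product≡F = toPoly-injective _ F (≈-trans (toPoly-product k≤n G H) GH≈F)

    -- Membership in a list of monics is decidable, so a split existing classically suffices.
    splits-complete : ∀ F → F ∈ splits
    splits-complete F = decidable-stable (F ∈? splits) (¬¬-map found (split-exists m F))
      where
      open DecMembership (VecP.≡-dec _≟_) using (_∈?_)
      found : Split m (toPoly F) → F ∈ splits
      found (split {k} {j} G H G-noGaps H-rough GH≈F) =
        member F G H (trans (sym (ℕP.m+n∸m≡n k j)) (cong (_∸ k) k+j≡n))
               (subst (k ≤_) k+j≡n (ℕP.m≤m+n k j)) G-noGaps H-rough GH≈F
        where
        k+j≡n : k ℕ.+ j ≡ n
        k+j≡n = monic-degree-unique (G *ₘ H) F (≈-trans (toPoly-*ₘ G H) GH≈F)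

    count-splits : sum (applyUpTo (λ k → Nf k ℕ.* Nr k) (suc n)) ≡ q ^ n
    count-splits = begin
      sum (applyUpTo (λ k → Nf k ℕ.* Nr k) (suc n))
        ≡⟨ cong sum (applyUpTo-cong (suc n) λ {k} _ → length-block {k}) ⟨
      sum (applyUpTo (λ k → length (block k)) (suc n))
        ≡⟨ cong sum (LP.map-applyUpTo block length (suc n)) ⟨
      sum (map length (applyUpTo block (suc n)))
        ≡⟨ length-concat (applyUpTo block (suc n)) ⟨
      length splits
        ≡⟨ unique-complete-length splits-unique (monics-unique n) splits-complete (monics-complete n) ⟩
      length (monics n)
        ≡⟨ monics-length n ⟩
      q ^ n ∎

open import Data.Nat using (_+_)
open import Data.Rational using (_*_)

lemma3p2 : {q : ℕ} .{{_ : NonZero q}} (𝔽 : FiniteField q)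
           (f r : ℕ → ℕ → ℚ) →
           (∀ k m → Polys.IsProportion 𝔽 k (Polys.NoGaps 𝔽 m {k}) (f k m)) →
           (∀ j m → Polys.IsProportion 𝔽 j (Polys.Rough 𝔽 m {j}) (r j m)) →
           (n m : ℕ) →
           1ℚ ≡ sumTo n (λ k → f k m * r (n ∸ k) (k + m))
lemma3p2 {q} 𝔽 f r f-proportion r-proportion n m = begin
  1ℚ                                                       ≡⟨ n/n≡1 (q ^ n) ⟨
  + q ^ n / q ^ n                                          ≡⟨ cong (λ N → + N / q ^ n) count ⟨
  + sum (applyUpTo (λ k → Nf k ℕ.* Nr k) (suc n)) / q ^ n  ≡⟨ sum-/ (q ^ n) (λ k → Nf k ℕ.* Nr k) (suc n) ⟨
  ∑ (applyUpTo (λ k → + (Nf k ℕ.* Nr k) / q ^ n) (suc n))  ≡⟨ cong ∑ (applyUpTo-cong (suc n) term) ⟨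
  ∑ (applyUpTo g (suc n))                                  ≡⟨ cong ∑ (LP.map-upTo g (suc n)) ⟨
  sumTo n g                                                ∎
  where
  open import Data.Integer using (+_)
  open ≡-Reasoning
  instance
    q^n≢0 : NonZero (q ^ n)
    q^n≢0 = ℕP.m^n≢0 q n
  ∑ : List ℚ → ℚ
  ∑ = foldr ℚ._+_ 0ℚ
  g : ℕ → ℚ
  g k = f k m * r (n ∸ k) (k + m)
  Nf Nr : ℕ → ℕ
  Nf k = proj₁ (f-proportion k m)
  Nr k = proj₁ (r-proportion (n ∸ k) (k ℕ.+ m))
  count : sum (applyUpTo (λ k → Nf k ℕ.* Nr k) (suc n)) ≡ q ^ n
  count = MonicFactorisation.SplitCount.count-splits 𝔽 m n
            (λ k → proj₁ (proj₂ (f-proportion k m))) (λ k → proj₁ (proj₂ (r-proportion (n ∸ k) (k ℕ.+ m))))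
  term : ∀ {k} → k < suc n → g k ≡ + (Nf k ℕ.* Nr k) / q ^ n
  term {k} (s≤s k≤n) =
    trans (cong₂ ℚ._*_ (proj₂ (proj₂ (f-proportion k m))) (proj₂ (proj₂ (r-proportion (n ∸ k) (k ℕ.+ m)))))
          (/-* (Nf k) (q ^ k) (Nr k) (q ^ (n ∸ k)) {{ℕP.m^n≢0 q k}} {{ℕP.m^n≢0 q (n ∸ k)}} (m^n*m^[o∸n]≡m^o q k≤n))
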